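{- Let $G$ be a finite simple graph. If $G$ has no adjacent twins, then every vertex of $G$ has at most one nonadjacent co-twin. If $G$ has no nonadjacent twins, then every vertex of $G$ has at most one adjacent co-twin.
   Context: In a graph $G=(V,E)$, $N(u)$ is the open and $N[u]=N(u)\cup\{u\}$ the closed neighborhood. Distinct vertices $u,v$ are nonadjacent twins if $N(u)=N(v)$ and adjacent twins if $N[u]=N[v]$. Distinct vertices $u,v$ are nonadjacent co-twins if $N[u]=V\setminus N[v]$ (i.e., $V=N[u]\sqcup N[v]$), and adjacent co-twins if $N(u)=V\setminus N(v)$ (i.e., $V=N(u)\sqcup N(v)$). -}

module Defs where

open import Level using (Level; suc; _⊔_) renaming (zero to lzero)
open import Data.Nat using (ℕ)
open import Data.Fin using (Fin)
open import Data.Sum using (_⊎_)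
open import Data.Product using (_×_)
open import Relation.Nullary using (¬_; Dec)
open import Relation.Binary.PropositionalEquality using (_≡_)
open import Function.Bundles using (_⇔_)

record SimpleGraph (n : ℕ) : Set₁ where
  field
    Adj     : Fin n → Fin n → Set
    adj?    : ∀ u v → Dec (Adj u v)
    sym     : ∀ {u v} → Adj u v → Adj v u
    irrefl  : ∀ {u} → ¬ Adj u u

module _ {n : ℕ} (G : SimpleGraph n) where
  open SimpleGraph G

  InN : Fin n → Fin n → Set
  InN u w = Adj u w

  InN[] : Fin n → Fin n → Set
  InN[] u w = Adj u w ⊎ w ≡ u

  NonAdjTwins : Fin n → Fin n → Set
  NonAdjTwins u v = ¬ (u ≡ v) × (∀ w → InN u w ⇔ InN v w)

  AdjTwins : Fin n → Fin n → Set
  AdjTwins u v = ¬ (u ≡ v) × (∀ w → InN[] u w ⇔ InN[] v w)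

  -- u, v distinct with V = N[u] ⊔ N[v] (disjoint union), i.e.
  -- every vertex lies in exactly one of N[u], N[v].
  NonAdjCoTwins : Fin n → Fin n → Set
  NonAdjCoTwins u v = ¬ (u ≡ v) × (∀ w → InN[] u w ⇔ (¬ InN[] v w))

  -- u, v distinct with V = N(u) ⊔ N(v) (disjoint union).
  AdjCoTwins : Fin n → Fin n → Set
  AdjCoTwins u v = ¬ (u ≡ v) × (∀ w → InN u w ⇔ (¬ InN v w))

  HasNoAdjTwins : Set
  HasNoAdjTwins = ∀ u v → ¬ AdjTwins u v

  HasNoNonAdjTwins : Set
  HasNoNonAdjTwins = ∀ u v → ¬ NonAdjTwins u v

{-# OPTIONS --safe #-}
module Submission where

open import Defs
open import Data.Nat using (ℕ)
open import Data.Fin.Properties using (_≟_)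
open import Data.Product using (_×_; _,_)
open import Relation.Nullary using (¬_; Dec)
open import Relation.Nullary.Decidable using (_⊎-dec_; decidable-stable)
open import Relation.Binary.PropositionalEquality using (_≡_)
open import Function.Bundles using (_⇔_; mk⇔; Equivalence)

-- A co-twin v of u has as neighbourhood the complement of that of u, so all
-- co-twins of u share one neighbourhood: two distinct ones would be twins.

complement-unique : ∀ {P Q R : Set} → Dec Q → Dec R → P ⇔ (¬ Q) → P ⇔ (¬ R) → Q ⇔ R
complement-unique Q? R? P⇔¬Q P⇔¬R = mk⇔ (implies R? P⇔¬Q P⇔¬R) (implies Q? P⇔¬R P⇔¬Q)
  where
  implies : ∀ {P Q R : Set} → Dec R → P ⇔ (¬ Q) → P ⇔ (¬ R) → Q → R
  implies R? P⇔¬Q P⇔¬R q =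
    decidable-stable R? λ ¬r → Equivalence.to P⇔¬Q (Equivalence.from P⇔¬R ¬r) q

module _ {n : ℕ} (G : SimpleGraph n) where
  open SimpleGraph G

  InN[]? : ∀ u w → Dec (InN[] G u w)
  InN[]? u w = adj? u w ⊎-dec w ≟ u

  nonAdjCoTwins⇒sameN[] : ∀ {u v v′} → NonAdjCoTwins G u v → NonAdjCoTwins G u v′ →
                          ∀ w → InN[] G v w ⇔ InN[] G v′ w
  nonAdjCoTwins⇒sameN[] {v = v} {v′} (_ , coV) (_ , coV′) w =
    complement-unique (InN[]? v w) (InN[]? v′ w) (coV w) (coV′ w)

  adjCoTwins⇒sameN : ∀ {u v v′} → AdjCoTwins G u v → AdjCoTwins G u v′ →
                     ∀ w → InN G v w ⇔ InN G v′ w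
  adjCoTwins⇒sameN {v = v} {v′} (_ , coV) (_ , coV′) w =
    complement-unique (adj? v w) (adj? v′ w) (coV w) (coV′ w)

lemma27 : ∀ {n : ℕ} (G : SimpleGraph n) →
    (HasNoAdjTwins G → ∀ u v v′ → NonAdjCoTwins G u v → NonAdjCoTwins G u v′ → v ≡ v′)
    × (HasNoNonAdjTwins G → ∀ u v v′ → AdjCoTwins G u v → AdjCoTwins G u v′ → v ≡ v′)
lemma27 G =
  (λ noTwins _ v v′ co co′ → decidable-stable (v ≟ v′) λ v≢v′ →
     noTwins v v′ (v≢v′ , nonAdjCoTwins⇒sameN[] G co co′))
  ,
  (λ noTwins _ v v′ co co′ → decidable-stable (v ≟ v′) λ v≢v′ →
     noTwins v v′ (v≢v′ , adjCoTwins⇒sameN G co co′))
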